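{- If $\tau(m)$ is prime, then $m$ is not $k$-near-perfect for any integer $k\ge0$. Consequently, if $m$ is $k$-near-perfect for some integer $k\ge0$, then $\tau(m)\ge4$.
   Context: $\tau(m)$ is the number of positive divisors of $m$. A natural number $m$ is $k$-near-perfect if $m$ equals the sum of all of its proper divisors except for at most $k$ of them ($0$-near-perfect means perfect). -}

module Defs where

open import Data.Nat using (ℕ; suc; _+_; _∸_; _≤_)
open import Data.Nat.Divisibility using (_∣?_)
open import Data.List using (List; applyUpTo; filter; length)
open import Data.Nat.ListAction using (sum)
open import Relation.Binary.PropositionalEquality using (_≡_)
open import Data.List.Relation.Binary.Sublist.Propositional using (_⊆_)
open import Data.Product using (Σ; _×_)

divisors : ℕ → List ℕ
divisors m = filter (_∣? m) (applyUpTo suc m)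

τ : ℕ → ℕ
τ m = length (divisors m)

properDivisors : ℕ → List ℕ
properDivisors m = filter (_∣? m) (applyUpTo suc (m ∸ 1))

-- m is k-near-perfect: there is a set S of at most k proper divisors
-- (a sublist of the strictly increasing list of proper divisors, hence a set)
-- such that m equals the sum of the proper divisors not in S,
-- i.e. (sum of proper divisors) = m + (sum of S).
NearPerfect : ℕ → ℕ → Set
NearPerfect k m =
  Σ (List ℕ) λ S → (S ⊆ properDivisors m) × (length S ≤ k) × (sum (properDivisors m) ≡ m + sum S)

module Submission where

-- If m is k-near-perfect, then σ(m) = (sum of proper divisors) + m ≥ 2m, so m
-- is not deficient.  On the other hand every m ≥ 1 is either deficient or has a
-- divisor count τ(m) that is a product of two factors ≥ 2:  writing
-- m = p^(a+1)·n with p a prime and p ∤ n, either n = 1 and m is a prime power,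
-- which is deficient (σ(p^(a+1)) = 1 + p·σ(p^a) < 2p^(a+1)), or n ≥ 2 and
-- τ(m) = (a+2)·τ(n) with τ(n) ≥ 2.  Hence τ of a near-perfect number is a
-- nontrivial product: it is not prime, and it is at least 4.

open import Defs
open import Level using (0ℓ)
open import Function using (_∘_)
open import Data.Nat
open import Data.Nat.Properties
open import Data.Nat.Divisibility
open import Data.Nat.Coprimality using (Coprime; coprime-divisor)
open import Data.Nat.Primality
  using (Prime; Composite; composite; prime⇒irreducible; prime⇒nonZero; prime⇒nonTrivial)
open import Data.Nat.Primality.Factorisation using (factorise)
open import Data.Nat.Induction using (<-wellFounded)
open import Induction.WellFounded using (Acc; acc)
open import Data.Nat.ListAction using (sum; product)
open import Data.Nat.ListAction.Properties using (sum-++)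
open import Data.List using ([]; _∷_; _++_; applyUpTo; filter; length)
open import Data.List.Properties using (filter-++; length-++; applyUpTo-∷ʳ)
open import Data.List.Relation.Unary.All using (_∷_)
open import Data.Product using (∃; ∃₂; _×_; _,_)
open import Data.Sum using (_⊎_; inj₁; inj₂)
open import Relation.Nullary using (¬_; Dec; yes; no; contradiction)
open import Relation.Unary using (Pred; Decidable)
open import Relation.Binary.PropositionalEquality
open import Algebra.Properties.CommutativeSemigroup +-commutativeSemigroup
  using (interchange)

select : {A : Set} → Dec A → ℕ → ℕ
select (yes _) x = x
select (no _)  _ = 0

select-yes : {A : Set} (A? : Dec A) → A → ∀ x → select A? x ≡ x
select-yes (yes _) _ x = refl
select-yes (no ¬a) a _ = contradiction a ¬a

select-no : {A : Set} (A? : Dec A) → ¬ A → ∀ x → select A? x ≡ 0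
select-no (yes a) ¬a _ = contradiction a ¬a
select-no (no _)  _  _ = refl

select-cong : {A B : Set} → (A → B) → (B → A) →
              (A? : Dec A) (B? : Dec B) → ∀ x → select A? x ≡ select B? x
select-cong A⇒B B⇒A A? B? x with A? | B?
... | yes _ | yes _ = refl
... | no _  | no _  = refl
... | yes a | no ¬b = contradiction (A⇒B a) ¬b
... | no ¬a | yes b = contradiction (B⇒A b) ¬a

select-*ˡ : {A : Set} → ∀ k (A? : Dec A) x → select A? (k * x) ≡ k * select A? x
select-*ˡ k (yes _) x = refl
select-*ˡ k (no _)  x = sym (*-zeroʳ k)

sumTo : ℕ → (ℕ → ℕ) → ℕ
sumTo zero    f = 0
sumTo (suc R) f = sumTo R f + f (suc R)

sumTo-cong : ∀ R {f g : ℕ → ℕ} → (∀ {d} → 1 ≤ d → d ≤ R → f d ≡ g d) →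
             sumTo R f ≡ sumTo R g
sumTo-cong zero    eq = refl
sumTo-cong (suc R) eq =
  cong₂ _+_ (sumTo-cong R (λ 1≤d d≤R → eq 1≤d (m≤n⇒m≤1+n d≤R))) (eq (s≤s z≤n) ≤-refl)

sumTo-+ : ∀ R (f g : ℕ → ℕ) → sumTo R (λ d → f d + g d) ≡ sumTo R f + sumTo R g
sumTo-+ zero    f g = refl
sumTo-+ (suc R) f g =
  trans (cong (_+ (f (suc R) + g (suc R))) (sumTo-+ R f g)) (interchange (sumTo R f) (sumTo R g) (f (suc R)) (g (suc R)))

sumTo-*ˡ : ∀ k R (f : ℕ → ℕ) → sumTo R (λ d → k * f d) ≡ k * sumTo R f
sumTo-*ˡ k zero    f = sym (*-zeroʳ k)
sumTo-*ˡ k (suc R) f =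
  trans (cong (_+ k * f (suc R)) (sumTo-*ˡ k R f)) (sym (*-distribˡ-+ k _ _))

term≤sumTo : ∀ (f : ℕ → ℕ) {d} R → 1 ≤ d → d ≤ R → f d ≤ sumTo R f
term≤sumTo f zero    (s≤s _) ()
term≤sumTo f (suc R) 1≤d d≤1+R with m≤n⇒m<n∨m≡n d≤1+R
... | inj₁ d<1+R = ≤-trans (term≤sumTo f R 1≤d (s≤s⁻¹ d<1+R)) (m≤m+n _ _)
... | inj₂ refl  = m≤n+m _ _

sumTo-extend : ∀ (f : ℕ → ℕ) {R R'} → R ≤ R' →
               (∀ {d} → R < d → d ≤ R' → f d ≡ 0) → sumTo R' f ≡ sumTo R f
sumTo-extend f {R} {zero}   z≤n    vanish = refl
sumTo-extend f {R} {suc R'} R≤1+R' vanish with m≤n⇒m<n∨m≡n R≤1+R'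
... | inj₂ refl  = refl
... | inj₁ R<1+R' = begin
  sumTo R' f + f (suc R')
    ≡⟨ cong₂ _+_ (sumTo-extend f (s≤s⁻¹ R<1+R')
                   (λ R<d d≤R' → vanish R<d (m≤n⇒m≤1+n d≤R')))
                 (vanish R<1+R' ≤-refl) ⟩
  sumTo R f + 0
    ≡⟨ +-identityʳ _ ⟩
  sumTo R f ∎
  where open ≡-Reasoning

sumTo-gap : ∀ (f : ℕ → ℕ) {R R'} → R < R' →
            (∀ {d} → R < d → d < R' → f d ≡ 0) → sumTo R' f ≡ sumTo R f + f R'
sumTo-gap f {R} {suc R'} (s≤s R≤R') vanish =
  cong (_+ f (suc R')) (sumTo-extend f R≤R' (λ R<d d≤R' → vanish R<d (s≤s d≤R')))

noMultipleBetween : ∀ p N {d} .{{_ : NonZero p}} →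
                    p * N < d → d < p * suc N → ¬ p ∣ d
noMultipleBetween p N {d} pN<d d<pN+p p∣d = <⇒≱ i<p (∣⇒≤ {{>-nonZero 0<i}} p∣i)
  where
  i = d ∸ p * N
  0<i : 0 < i
  0<i = m<n⇒0<n∸m pN<d
  i<p : i < p
  i<p = m<n+o⇒m∸n<o d (p * N) (subst (d <_) (trans (*-suc p N) (+-comm p (p * N))) d<pN+p)
  p∣i : p ∣ i
  p∣i = ∣m+n∣m⇒∣n (subst (p ∣_) (sym (m+[n∸m]≡n (<⇒≤ pN<d))) p∣d) (m∣m*n N)

sumTo-multiples : ∀ p N (f : ℕ → ℕ) .{{_ : NonZero p}} →
                  (∀ {d} → ¬ p ∣ d → f d ≡ 0) →
                  sumTo (p * N) f ≡ sumTo N (λ e → f (p * e))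
sumTo-multiples p zero    f vanish = cong (λ R → sumTo R f) (*-zeroʳ p)
sumTo-multiples p (suc N) f vanish = begin
  sumTo (p * suc N) f
    ≡⟨ sumTo-gap f (*-monoʳ-< p (n<1+n N))
         (λ pN<d d<pN+p → vanish (noMultipleBetween p N pN<d d<pN+p)) ⟩
  sumTo (p * N) f + f (p * suc N)
    ≡⟨ cong (_+ f (p * suc N)) (sumTo-multiples p N f vanish) ⟩
  sumTo N (λ e → f (p * e)) + f (p * suc N) ∎
  where open ≡-Reasoning

divisorSum : (ℕ → ℕ) → ℕ → ℕ
divisorSum w X = sumTo X (λ d → select (d ∣? X) (w d))

divisorCount : ℕ → ℕ
divisorCount = divisorSum (λ _ → 1)

σ : ℕ → ℕ
σ = divisorSum (λ d → d)

divisorSum-*ˡ : ∀ k (w : ℕ → ℕ) X → divisorSum (λ d → k * w d) X ≡ k * divisorSum w X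
divisorSum-*ˡ k w X =
  trans (sumTo-cong X (λ {d} _ _ → select-*ˡ k (d ∣? X) (w d))) (sumTo-*ˡ k X _)

module _ {P : Pred ℕ 0ℓ} (P? : Decidable P) where

  filter-upTo-suc : ∀ R → filter P? (applyUpTo suc (suc R))
                          ≡ filter P? (applyUpTo suc R) ++ filter P? (suc R ∷ [])
  filter-upTo-suc R =
    trans (cong (filter P?) (sym (applyUpTo-∷ʳ suc R))) (filter-++ P? (applyUpTo suc R) _)

  length-filter-upTo : ∀ R → length (filter P? (applyUpTo suc R)) ≡ sumTo R (λ d → select (P? d) 1)
  length-filter-upTo zero    = refl
  length-filter-upTo (suc R) = begin
    length (filter P? (applyUpTo suc (suc R)))
      ≡⟨ cong length (filter-upTo-suc R) ⟩
    length (filter P? (applyUpTo suc R) ++ filter P? (suc R ∷ []))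
      ≡⟨ length-++ (filter P? (applyUpTo suc R)) ⟩
    length (filter P? (applyUpTo suc R)) + length (filter P? (suc R ∷ []))
      ≡⟨ cong₂ _+_ (length-filter-upTo R) (length-singleton (suc R)) ⟩
    sumTo R (λ d → select (P? d) 1) + select (P? (suc R)) 1 ∎
    where
    open ≡-Reasoning
    length-singleton : ∀ x → length (filter P? (x ∷ [])) ≡ select (P? x) 1
    length-singleton x with P? x
    ... | yes _ = refl
    ... | no _  = refl

  sum-filter-upTo : ∀ R → sum (filter P? (applyUpTo suc R)) ≡ sumTo R (λ d → select (P? d) d)
  sum-filter-upTo zero    = refl
  sum-filter-upTo (suc R) = begin
    sum (filter P? (applyUpTo suc (suc R)))
      ≡⟨ cong sum (filter-upTo-suc R) ⟩
    sum (filter P? (applyUpTo suc R) ++ filter P? (suc R ∷ []))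
      ≡⟨ sum-++ (filter P? (applyUpTo suc R)) _ ⟩
    sum (filter P? (applyUpTo suc R)) + sum (filter P? (suc R ∷ []))
      ≡⟨ cong₂ _+_ (sum-filter-upTo R) (sum-singleton (suc R)) ⟩
    sumTo R (λ d → select (P? d) d) + select (P? (suc R)) (suc R) ∎
    where
    open ≡-Reasoning
    sum-singleton : ∀ x → sum (filter P? (x ∷ [])) ≡ select (P? x) x
    sum-singleton x with P? x
    ... | yes _ = +-identityʳ x
    ... | no _  = refl

τ≡divisorCount : ∀ m → τ m ≡ divisorCount m
τ≡divisorCount m = length-filter-upTo (_∣? m) m

σ≡properSum+m : ∀ m → 1 ≤ m → σ m ≡ sum (properDivisors m) + m
σ≡properSum+m m@(suc m') _ =
  cong₂ _+_ (sym (sum-filter-upTo (_∣? m) m')) (select-yes (m ∣? m) ∣-refl m)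

nearPerfect⇒2m≤σ : ∀ {k m} → 1 ≤ m → NearPerfect k m → 2 * m ≤ σ m
nearPerfect⇒2m≤σ {m = m} 1≤m (S , _ , _ , properSum≡m+ΣS) = begin
  2 * m                       ≡⟨ cong (m +_) (+-identityʳ m) ⟩
  m + m                       ≤⟨ +-monoˡ-≤ m (m≤m+n m (sum S)) ⟩
  (m + sum S) + m             ≡⟨ cong (_+ m) (sym properSum≡m+ΣS) ⟩
  sum (properDivisors m) + m  ≡⟨ sym (σ≡properSum+m m 1≤m) ⟩
  σ m                         ∎
  where open ≤-Reasoning

-- Every n ≥ 2 has the two divisors 1 and n.
divisorCount≥2 : ∀ n → 2 ≤ n → 2 ≤ divisorCount n
divisorCount≥2 n@(suc n') (s≤s 1≤n') =
  +-mono-≤ (≤-trans (≤-reflexive (sym (select-yes (1 ∣? n) (1∣ n) 1)))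
                    (term≤sumTo (λ d → select (d ∣? n) 1) n' ≤-refl 1≤n'))
           (≤-reflexive (sym (select-yes (n ∣? n) ∣-refl 1)))

primeDivisor : ∀ m → 2 ≤ m → ∃ λ p → Prime p × p ∣ m
primeDivisor (suc zero) (s≤s ())
primeDivisor m@(suc (suc _)) _ with factorise m
... | record { factors = [] ; isFactorisation = () }
... | record { factors = p ∷ ps ; isFactorisation = m≡p*Πps ; factorsPrime = p-prime ∷ _ } =
  p , p-prime , divides (product ps) (trans m≡p*Πps (*-comm p (product ps)))

module _ {p : ℕ} (p-prime : Prime p) where

  private instance
    p≢0 : NonZero p
    p≢0 = prime⇒nonZero p-prime

  1<p : 1 < p
  1<p = nonTrivial⇒n>1 p {{prime⇒nonTrivial p-prime}}

  p∤1 : ¬ p ∣ 1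
  p∤1 p∣1 = <⇒≢ 1<p (sym (∣1⇒≡1 p∣1))

  nonMultiple⇒coprime : ∀ {d} → ¬ p ∣ d → Coprime d p
  nonMultiple⇒coprime p∤d {i} (i∣d , i∣p) with prime⇒irreducible p-prime i∣p
  ... | inj₁ i≡1 = i≡1
  ... | inj₂ refl = contradiction i∣d p∤d

  stripPower : ∀ {d} → ¬ p ∣ d → ∀ a n → d ∣ p ^ a * n → d ∣ n
  stripPower {d} p∤d zero    n d∣1*n = subst (d ∣_) (*-identityˡ n) d∣1*n
  stripPower {d} p∤d (suc a) n d∣pᵃ⁺¹n =
    stripPower p∤d a n (coprime-divisor (nonMultiple⇒coprime p∤d)
                                        (subst (d ∣_) (*-assoc p (p ^ a) n) d∣pᵃ⁺¹n))

  -- The divisors of p·p^a·n (p ∤ n) split into those coprime to p, which are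
  -- the divisors of n, and the multiples p·e, where e ranges over the
  -- divisors of p^a·n.
  divisorSum-step : ∀ (w : ℕ → ℕ) a n → ¬ p ∣ n → 1 ≤ n →
    divisorSum w (p * (p ^ a * n)) ≡ divisorSum w n + divisorSum (λ e → w (p * e)) (p ^ a * n)
  divisorSum-step w a n p∤n 1≤n = begin
    sumTo M (λ d → select (d ∣? M) (w d))
      ≡⟨ sumTo-cong M (λ {d} _ _ → splitTerm d) ⟩
    sumTo M (λ d → select (d ∣? n) (w d) + multipleTerm d)
      ≡⟨ sumTo-+ M _ multipleTerm ⟩
    sumTo M (λ d → select (d ∣? n) (w d)) + sumTo M multipleTerm
      ≡⟨ cong₂ _+_ coprimePart multiplePart ⟩
    divisorSum w n + divisorSum (λ e → w (p * e)) N ∎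
    where
    open ≡-Reasoning
    N = p ^ a * n
    M = p * N

    multipleTerm : ℕ → ℕ
    multipleTerm d = select (p ∣? d) (select (d ∣? M) (w d))

    splitTerm : ∀ d → select (d ∣? M) (w d) ≡ select (d ∣? n) (w d) + multipleTerm d
    splitTerm d with p ∣? d
    ... | yes p∣d = cong (_+ select (d ∣? M) (w d))
                         (sym (select-no (d ∣? n) (λ d∣n → p∤n (∣-trans p∣d d∣n)) (w d)))
    ... | no p∤d = trans (select-cong (stripPower p∤d (suc a) n ∘ subst (d ∣_) (sym (*-assoc p (p ^ a) n)))
                                      (λ d∣n → ∣-trans d∣n (∣-trans (n∣m*n (p ^ a)) (n∣m*n p)))
                                      (d ∣? M) (d ∣? n) (w d))
                         (sym (+-identityʳ _))

    n≤M : n ≤ M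
    n≤M = ≤-trans (m≤n*m n (p ^ a) {{m^n≢0 p a}}) (m≤n*m N p)

    coprimePart : sumTo M (λ d → select (d ∣? n) (w d)) ≡ divisorSum w n
    coprimePart = sumTo-extend _ n≤M
      (λ {d} n<d _ → select-no (d ∣? n) (λ d∣n → <⇒≱ n<d (∣⇒≤ {{>-nonZero 1≤n}} d∣n)) (w d))

    multiplePart : sumTo M multipleTerm ≡ divisorSum (λ e → w (p * e)) N
    multiplePart =
      trans (sumTo-multiples p N multipleTerm (λ {d} p∤d → select-no (p ∣? d) p∤d _))
            (sumTo-cong N (λ {e} _ _ →
              trans (select-yes (p ∣? p * e) (m∣m*n e) _)
                    (select-cong (*-cancelˡ-∣ p) (*-monoʳ-∣ p) (p * e ∣? M) (e ∣? N) (w (p * e)))))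

  divisorCount-power : ∀ a n → ¬ p ∣ n → 1 ≤ n →
                       divisorCount (p ^ a * n) ≡ suc a * divisorCount n
  divisorCount-power zero    n p∤n 1≤n =
    trans (cong divisorCount (*-identityˡ n)) (sym (*-identityˡ _))
  divisorCount-power (suc a) n p∤n 1≤n = begin
    divisorCount (p ^ suc a * n)
      ≡⟨ cong divisorCount (*-assoc p (p ^ a) n) ⟩
    divisorCount (p * (p ^ a * n))
      ≡⟨ divisorSum-step (λ _ → 1) a n p∤n 1≤n ⟩
    divisorCount n + divisorCount (p ^ a * n)
      ≡⟨ cong (divisorCount n +_) (divisorCount-power a n p∤n 1≤n) ⟩
    divisorCount n + suc a * divisorCount n ∎
    where open ≡-Reasoning

  σ-power-step : ∀ a → σ (p ^ suc a) ≡ 1 + p * σ (p ^ a)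
  σ-power-step a = begin
    σ (p * p ^ a)                      ≡⟨ cong (σ ∘ (p *_)) (sym (*-identityʳ (p ^ a))) ⟩
    σ (p * (p ^ a * 1))                ≡⟨ divisorSum-step (λ d → d) a 1 p∤1 ≤-refl ⟩
    1 + divisorSum (p *_) (p ^ a * 1)  ≡⟨ cong (λ X → 1 + divisorSum (p *_) X) (*-identityʳ (p ^ a)) ⟩
    1 + divisorSum (p *_) (p ^ a)      ≡⟨ cong (1 +_) (divisorSum-*ˡ p (λ d → d) (p ^ a)) ⟩
    1 + p * σ (p ^ a)                  ∎
    where open ≡-Reasoning

  primePower-deficient : ∀ a → σ (p ^ a) < 2 * p ^ a
  primePower-deficient zero    = ≤-refl
  primePower-deficient (suc a) = begin-strict
    σ (p ^ suc a)            ≡⟨ σ-power-step a ⟩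
    1 + p * σ (p ^ a)        <⟨ +-monoˡ-< (p * σ (p ^ a)) 1<p ⟩
    p + p * σ (p ^ a)        ≡⟨ sym (*-suc p (σ (p ^ a))) ⟩
    p * suc (σ (p ^ a))      ≤⟨ *-monoʳ-≤ p (primePower-deficient a) ⟩
    p * (2 * p ^ a)          ≡⟨ sym (*-assoc p 2 (p ^ a)) ⟩
    (p * 2) * p ^ a          ≡⟨ cong (_* p ^ a) (*-comm p 2) ⟩
    (2 * p) * p ^ a          ≡⟨ *-assoc 2 p (p ^ a) ⟩
    2 * p ^ suc a            ∎
    where open ≤-Reasoning

  -- Every m ≥ 1 factors as p^a·n with p ∤ n (by well-founded recursion:
  -- if p ∣ m then m = q·p with q < m).
  splitPower : ∀ m → 1 ≤ m → ∃₂ λ a n → m ≡ p ^ a * n × ¬ p ∣ n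
  splitPower m 1≤m = split m 1≤m (<-wellFounded m)
    where
    split : ∀ m → 1 ≤ m → Acc _<_ m → ∃₂ λ a n → m ≡ p ^ a * n × ¬ p ∣ n
    split m 1≤m (acc smaller) with p ∣? m
    ... | no p∤m = 0 , m , sym (*-identityˡ m) , p∤m
    ... | yes (divides zero m≡0) = contradiction (subst (1 ≤_) m≡0 1≤m) λ ()
    ... | yes (divides q@(suc _) m≡qp)
      with a , n , q≡pᵃn , p∤n ← split q (s≤s z≤n) (smaller (subst (q <_) (sym m≡qp) (m<m*n q p 1<p)))
      = suc a , n , m≡pᵃ⁺¹n , p∤n
      where
      m≡pᵃ⁺¹n : m ≡ p ^ suc a * n
      m≡pᵃ⁺¹n = trans m≡qp (trans (cong (_* p) q≡pᵃn)
                  (trans (*-comm (p ^ a * n) p) (sym (*-assoc p (p ^ a) n))))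

NontrivialProduct : ℕ → Set
NontrivialProduct t = ∃₂ λ a b → 2 ≤ a × 2 ≤ b × t ≡ a * b

nontrivialProduct⇒¬prime : ∀ {t} → NontrivialProduct t → ¬ Prime t
nontrivialProduct⇒¬prime (a@(suc (suc _)) , b , s≤s (s≤s z≤n) , 2≤b , t≡ab) t-prime =
  Prime.notComposite t-prime (subst Composite (sym t≡ab) (composite (m<m*n a b 2≤b) (m∣m*n b)))

nontrivialProduct⇒4≤ : ∀ {t} → NontrivialProduct t → 4 ≤ t
nontrivialProduct⇒4≤ (a , b , 2≤a , 2≤b , t≡ab) = subst (4 ≤_) (sym t≡ab) (*-mono-≤ 2≤a 2≤b)

deficient-or-τ-product : ∀ m → 1 ≤ m → σ m < 2 * m ⊎ NontrivialProduct (τ m)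
deficient-or-τ-product 1 _ = inj₁ ≤-refl
deficient-or-τ-product m@(suc (suc _)) _
  with p , p-prime , p∣m ← primeDivisor m (s≤s (s≤s z≤n))
  with splitPower p-prime m (s≤s z≤n)
... | zero , n , m≡1*n , p∤n =
  contradiction (subst (_ ∣_) (trans m≡1*n (*-identityˡ n)) p∣m) p∤n
... | suc a , zero , _ , p∤0 = contradiction (divides 0 refl) p∤0
... | suc a , 1 , m≡pᵃ⁺¹*1 , _ =
  inj₁ (subst (λ x → σ x < 2 * x) (sym (trans m≡pᵃ⁺¹*1 (*-identityʳ (p ^ suc a))))
              (primePower-deficient p-prime (suc a)))
... | suc a , n@(suc (suc _)) , m≡pᵃ⁺¹n , p∤n =
  inj₂ (suc (suc a) , divisorCount n , s≤s (s≤s z≤n) , divisorCount≥2 n (s≤s (s≤s z≤n)) ,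
        trans (τ≡divisorCount m) (trans (cong divisorCount m≡pᵃ⁺¹n)
                                        (divisorCount-power p-prime (suc a) n p∤n (s≤s z≤n))))

nearPerfect⇒τ-product : ∀ {k m} → 1 ≤ m → NearPerfect k m → NontrivialProduct (τ m)
nearPerfect⇒τ-product {m = m} 1≤m near-perfect with deficient-or-τ-product m 1≤m
... | inj₁ σ<2m = contradiction (nearPerfect⇒2m≤σ 1≤m near-perfect) (<⇒≱ σ<2m)
... | inj₂ τ-product = τ-product

corollary3p13 : (m : ℕ) → 1 ≤ m →
    (Prime (τ m) → (k : ℕ) → ¬ NearPerfect k m)
    × ((k : ℕ) → NearPerfect k m → 4 ≤ τ m)
corollary3p13 m 1≤m =
  (λ τ-prime k near-perfect → nontrivialProduct⇒¬prime (nearPerfect⇒τ-product 1≤m near-perfect) τ-prime) ,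
  (λ k near-perfect → nontrivialProduct⇒4≤ (nearPerfect⇒τ-product 1≤m near-perfect))
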